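{- Let $A\in\mathcal{A}^3_{\infty,0,7,8}$. If $A$ contains two distinct maximal $2$-cliques, then these two $2$-cliques partition the points of $A$: every point of $A$ lies in exactly one of them.
   Context: $\mathcal{A}^3_{\infty,0,7,8}$ is the class of finite metric spaces, all of whose distances between distinct points lie in $\{1,2,3\}$, in which for every three distinct points the multiset of their pairwise distances is one of $\{1,1,2\}$, $\{1,2,3\}$, $\{2,2,2\}$. A $2$-clique in such a space is a set of points any two distinct members of which are at distance $2$; it is maximal if it is not properly contained in a larger $2$-clique. -}

module Defs where

open import Data.Nat using (ℕ; _≤_; _+_)
open import Data.Fin using (Fin)
open import Data.Fin.Subset using (Subset; _∈_; _⊂_)
open import Data.Product using (_×_)
open import Data.Sum using (_⊎_)
open import Relation.Binary.PropositionalEquality using (_≡_; _≢_)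
open import Relation.Nullary using (¬_)

record IsMetric {n : ℕ} (d : Fin n → Fin n → ℕ) : Set where
  field
    d-refl  : ∀ x → d x x ≡ 0
    d-pos   : ∀ x y → x ≢ y → ¬ (d x y ≡ 0)
    d-sym   : ∀ x y → d x y ≡ d y x
    d-tri   : ∀ x y z → d x z ≤ d x y + d y z

-- Allowed triangles: multiset {d xy, d yz, d xz} ∈ { {1,1,2}, {1,2,3}, {2,2,2} }.
data AllowedTriangle : ℕ → ℕ → ℕ → Set where
  t112 : AllowedTriangle 1 1 2
  t121 : AllowedTriangle 1 2 1
  t211 : AllowedTriangle 2 1 1
  t123 : AllowedTriangle 1 2 3
  t132 : AllowedTriangle 1 3 2
  t213 : AllowedTriangle 2 1 3
  t231 : AllowedTriangle 2 3 1
  t312 : AllowedTriangle 3 1 2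
  t321 : AllowedTriangle 3 2 1
  t222 : AllowedTriangle 2 2 2

record InClass {n : ℕ} (d : Fin n → Fin n → ℕ) : Set where
  field
    metric    : IsMetric d
    distances : ∀ x y → x ≢ y → (d x y ≡ 1) ⊎ (d x y ≡ 2) ⊎ (d x y ≡ 3)
    triangles : ∀ x y z → x ≢ y → y ≢ z → x ≢ z →
                AllowedTriangle (d x y) (d y z) (d x z)

Is2Clique : {n : ℕ} → (Fin n → Fin n → ℕ) → Subset n → Set
Is2Clique d C = ∀ x y → x ∈ C → y ∈ C → x ≢ y → d x y ≡ 2

IsMax2Clique : {n : ℕ} → (Fin n → Fin n → ℕ) → Subset n → Set
IsMax2Clique d C = Is2Clique d C × (∀ D → Is2Clique d D → ¬ (C ⊂ D))

-- In this class a triangle with two sides of length 2 has all three of length 2,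
-- so "equal or at distance 2" is an equivalence relation and the maximal 2-cliques
-- are exactly its classes. Two distinct classes are disjoint, and a point outside
-- both would form, with one point of each, a triangle without a side of length 2,
-- which the class forbids.
module Submission where

open import Defs
open import Data.Nat using (ℕ)
open import Data.Fin using (Fin)
open import Data.Fin.Subset using (Subset; _∈_; _∉_; _⊆_; _∪_; ⁅_⁆; Nonempty)
open import Data.Fin.Subset.Properties
  using (_∈?_; nonempty?; ⊆-antisym; x∈p∪q⁻; p⊆p∪q; q⊆p∪q; x∈⁅x⁆; x∈⁅y⁆⇒x≡y)
open import Data.Fin.Properties using (_≟_)
open import Data.Product using (_×_; _,_)
open import Data.Sum using (_⊎_; inj₁; inj₂)
open import Data.Empty using (⊥; ⊥-elim)
open import Relation.Nullary using (yes; no)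
open import Relation.Binary.PropositionalEquality using (_≢_; _≡_; refl; sym; trans; subst₂)

AllowedTriangle-has-2 : ∀ {a b c} → AllowedTriangle a b c → a ≡ 2 ⊎ b ≡ 2 ⊎ c ≡ 2
AllowedTriangle-has-2 t112 = inj₂ (inj₂ refl)
AllowedTriangle-has-2 t121 = inj₂ (inj₁ refl)
AllowedTriangle-has-2 t211 = inj₁ refl
AllowedTriangle-has-2 t123 = inj₂ (inj₁ refl)
AllowedTriangle-has-2 t132 = inj₂ (inj₂ refl)
AllowedTriangle-has-2 t213 = inj₁ refl
AllowedTriangle-has-2 t231 = inj₁ refl
AllowedTriangle-has-2 t312 = inj₂ (inj₂ refl)
AllowedTriangle-has-2 t321 = inj₂ (inj₁ refl)
AllowedTriangle-has-2 t222 = inj₁ refl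

AllowedTriangle-22⇒2 : ∀ {c} → AllowedTriangle 2 2 c → c ≡ 2
AllowedTriangle-22⇒2 t222 = refl

module _ {n : ℕ} {d : Fin n → Fin n → ℕ} where

  ⁅⁆-is2Clique : ∀ x → Is2Clique d ⁅ x ⁆
  ⁅⁆-is2Clique x a b a∈ b∈ a≢b with x∈⁅y⁆⇒x≡y x a∈ | x∈⁅y⁆⇒x≡y x b∈
  ... | refl | refl = ⊥-elim (a≢b refl)

  max2Clique-nonempty : ∀ {C} → IsMax2Clique d C → Fin n → Nonempty C
  max2Clique-nonempty {C} (_ , maximal) x with nonempty? C
  ... | yes nonempty = nonempty
  ... | no empty = ⊥-elim (maximal ⁅ x ⁆ (⁅⁆-is2Clique x) (C⊆⁅x⁆ , x , x∈⁅x⁆ x , λ x∈C → empty (x , x∈C)))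
    where
    C⊆⁅x⁆ : C ⊆ ⁅ x ⁆
    C⊆⁅x⁆ {a} a∈C = ⊥-elim (empty (a , a∈C))

module _ {n : ℕ} {d : Fin n → Fin n → ℕ} (metric : IsMetric d) where
  open IsMetric metric

  d≡2⇒≢ : ∀ {x y} → d x y ≡ 2 → x ≢ y
  d≡2⇒≢ {x} dxx≡2 refl with trans (sym (d-refl x)) dxx≡2
  ... | ()

  is2Clique-∪⁅⁆ : ∀ {C y} → (∀ a → a ∈ C → a ≢ y → d a y ≡ 2) → Is2Clique d C →
                  Is2Clique d (C ∪ ⁅ y ⁆)
  is2Clique-∪⁅⁆ {C} {y} toY clique a b a∈ b∈ a≢b
    with x∈p∪q⁻ C ⁅ y ⁆ a∈ | x∈p∪q⁻ C ⁅ y ⁆ b∈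
  ... | inj₁ a∈C | inj₁ b∈C = clique a b a∈C b∈C a≢b
  ... | inj₁ a∈C | inj₂ b∈y with x∈⁅y⁆⇒x≡y y b∈y
  ...   | refl = toY a a∈C a≢b
  is2Clique-∪⁅⁆ toY clique a b a∈ b∈ a≢b | inj₂ a∈y | inj₁ b∈C with x∈⁅y⁆⇒x≡y _ a∈y
  ...   | refl = trans (d-sym a b) (toY b b∈C (λ b≡a → a≢b (sym b≡a)))
  is2Clique-∪⁅⁆ toY clique a b a∈ b∈ a≢b | inj₂ a∈y | inj₂ b∈y =
    ⁅⁆-is2Clique {d = d} _ a b a∈y b∈y a≢b

module _ {n : ℕ} {d : Fin n → Fin n → ℕ} (class : InClass d) where
  open InClass class
  open IsMetric metric

  d≡2-trans : ∀ {x y z} → d x y ≡ 2 → d y z ≡ 2 → x ≢ z → d x z ≡ 2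
  d≡2-trans {x} {y} {z} dxy≡2 dyz≡2 x≢z =
    AllowedTriangle-22⇒2 (subst₂ (λ a b → AllowedTriangle a b (d x z)) dxy≡2 dyz≡2
      (triangles x y z (d≡2⇒≢ metric dxy≡2) (d≡2⇒≢ metric dyz≡2) x≢z))

  max2Clique-closed : ∀ {C x y} → IsMax2Clique d C → x ∈ C → d x y ≡ 2 → y ∈ C
  max2Clique-closed {C} {x} {y} (clique , maximal) x∈C dxy≡2 with y ∈? C
  ... | yes y∈C = y∈C
  ... | no y∉C = ⊥-elim (maximal (C ∪ ⁅ y ⁆) (is2Clique-∪⁅⁆ metric toY clique)
                          (p⊆p∪q ⁅ y ⁆ , y , q⊆p∪q C ⁅ y ⁆ (x∈⁅x⁆ y) , y∉C))
    where
    toY : ∀ a → a ∈ C → a ≢ y → d a y ≡ 2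
    toY a a∈C a≢y with a ≟ x
    ... | yes refl = dxy≡2
    ... | no a≢x = d≡2-trans (clique a x a∈C x∈C a≢x) dxy≡2 a≢y

  max2Clique-⊆ : ∀ {C D x} → IsMax2Clique d C → IsMax2Clique d D → x ∈ C → x ∈ D → C ⊆ D
  max2Clique-⊆ {x = x} (clique , _) maxD x∈C x∈D {y} y∈C with y ≟ x
  ... | yes refl = x∈D
  ... | no y≢x = max2Clique-closed maxD x∈D (clique x y x∈C y∈C (λ x≡y → y≢x (sym x≡y)))

  max2Clique-disjoint : ∀ {C D x} → IsMax2Clique d C → IsMax2Clique d D → C ≢ D →
                        x ∈ C → x ∉ D
  max2Clique-disjoint maxC maxD C≢D x∈C x∈D =
    C≢D (⊆-antisym (max2Clique-⊆ maxC maxD x∈C x∈D) (max2Clique-⊆ maxD maxC x∈D x∈C))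

  max2Clique-cover : ∀ {C D x} → IsMax2Clique d C → IsMax2Clique d D → C ≢ D →
                     x ∉ C → x ∉ D → ⊥
  max2Clique-cover {C} {D} {x} maxC maxD C≢D x∉C x∉D
    with max2Clique-nonempty maxC x | max2Clique-nonempty maxD x
  ... | c , c∈C | e , e∈D =
    outside (AllowedTriangle-has-2 (triangles x c e x≢c c≢e x≢e))
    where
    x≢c : x ≢ c
    x≢c refl = x∉C c∈C
    x≢e : x ≢ e
    x≢e refl = x∉D e∈D
    c≢e : c ≢ e
    c≢e refl = max2Clique-disjoint maxC maxD C≢D c∈C e∈D
    outside : d x c ≡ 2 ⊎ d c e ≡ 2 ⊎ d x e ≡ 2 → ⊥
    outside (inj₁ dxc≡2) = x∉C (max2Clique-closed maxC c∈C (trans (d-sym c x) dxc≡2))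
    outside (inj₂ (inj₁ dce≡2)) =
      max2Clique-disjoint maxC maxD C≢D (max2Clique-closed maxC c∈C dce≡2) e∈D
    outside (inj₂ (inj₂ dxe≡2)) = x∉D (max2Clique-closed maxD e∈D (trans (d-sym e x) dxe≡2))

lemma2p6 : ∀ {n : ℕ} (d : Fin n → Fin n → ℕ) → InClass d →
           (C D : Subset n) → IsMax2Clique d C → IsMax2Clique d D → C ≢ D →
           ∀ (x : Fin n) → (x ∈ C × x ∉ D) ⊎ (x ∉ C × x ∈ D)
lemma2p6 d class C D maxC maxD C≢D x with x ∈? C | x ∈? D
... | yes x∈C | _     = inj₁ (x∈C , max2Clique-disjoint class maxC maxD C≢D x∈C)
... | no x∉C  | yes x∈D = inj₂ (x∉C , x∈D)
... | no x∉C  | no x∉D  = ⊥-elim (max2Clique-cover class maxC maxD C≢D x∉C x∉D)
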